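{- Let $G$ be a nut graph and let $v \in V(G)$. Then $\mathcal{P}(G,v)$ is a nut graph.
   Context: $\mathcal{P}(G,v)$ is the graph obtained from $G$ by fusing a triangle and a pentagon to the vertex $v$: add two new vertices adjacent to each other and to $v$, and four further new vertices $a,b,c,d$ with edges $va,ab,bc,cd,dv$. A nut graph is a simple connected graph whose adjacency matrix has one-dimensional kernel spanned by a vector with no zero entry ($K_1$ excluded as trivial). -}

module Defs where

open import Data.Nat using (ℕ; zero; suc; _+_; _≤_)
open import Data.Fin using (Fin; zero; suc; splitAt; _≟_)
open import Data.Bool using (Bool; true; false; if_then_else_; _∧_)
open import Data.Sum using (_⊎_; inj₁; inj₂)
open import Data.Product using (Σ; ∃; _×_; _,_)
open import Data.Rational using (ℚ; 0ℚ; 1ℚ) renaming (_+_ to _+ℚ_; _*_ to _*ℚ_)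
open import Relation.Nullary using (¬_)
open import Relation.Nullary.Decidable using (⌊_⌋)
open import Relation.Binary.PropositionalEquality using (_≡_; _≢_)

AdjRel : ℕ → Set
AdjRel n = Fin n → Fin n → Bool

IsSimple : ∀ {n} → AdjRel n → Set
IsSimple {n} A = (∀ (u w : Fin n) → A u w ≡ A w u) × (∀ (u : Fin n) → A u u ≡ false)

data Reach {n : ℕ} (A : AdjRel n) : Fin n → Fin n → Set where
  here : ∀ {u} → Reach A u u
  step : ∀ {u w x} → A u w ≡ true → Reach A w x → Reach A u x

IsConnected : ∀ {n} → AdjRel n → Set
IsConnected {n} A = ∀ (u w : Fin n) → Reach A u w

∑ : ∀ {n} → (Fin n → ℚ) → ℚ
∑ {zero} f = 0ℚ
∑ {suc n} f = f zero +ℚ ∑ (λ i → f (suc i))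

adjMat : ∀ {n} → AdjRel n → Fin n → Fin n → ℚ
adjMat A i j = if A i j then 1ℚ else 0ℚ

InKernel : ∀ {n} → AdjRel n → (Fin n → ℚ) → Set
InKernel A x = ∀ i → ∑ (λ j → adjMat A i j *ℚ x j) ≡ 0ℚ

IsNut : ∀ {n} → AdjRel n → Set
IsNut {n} A =
  2 ≤ n × IsSimple A × IsConnected A ×
  Σ (Fin n → ℚ) (λ x → InKernel A x × (∀ i → x i ≢ 0ℚ) ×
     (∀ y → InKernel A y → ∃ λ (c : ℚ) → ∀ i → y i ≡ c *ℚ x i))

-- new vertices: 0,1 = triangle vertices; 2,3,4,5 = a,b,c,d of the pentagon
-- edges among new vertices: 0-1, 2-3, 3-4, 4-5
newAdj : Fin 6 → Fin 6 → Bool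
newAdj zero (suc zero) = true
newAdj (suc zero) zero = true
newAdj (suc (suc zero)) (suc (suc (suc zero))) = true
newAdj (suc (suc (suc zero))) (suc (suc zero)) = true
newAdj (suc (suc (suc zero))) (suc (suc (suc (suc zero)))) = true
newAdj (suc (suc (suc (suc zero)))) (suc (suc (suc zero))) = true
newAdj (suc (suc (suc (suc zero)))) (suc (suc (suc (suc (suc zero))))) = true
newAdj (suc (suc (suc (suc (suc zero))))) (suc (suc (suc (suc zero)))) = true
newAdj _ _ = false

-- new vertices adjacent to v: both triangle vertices, a and d
attach : Fin 6 → Bool
attach zero = true
attach (suc zero) = true
attach (suc (suc zero)) = true
attach (suc (suc (suc (suc (suc zero))))) = true
attach _ = false

P-adj⊎ : ∀ {n} → AdjRel n → Fin n → Fin n ⊎ Fin 6 → Fin n ⊎ Fin 6 → Bool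
P-adj⊎ A v (inj₁ x) (inj₁ y) = A x y
P-adj⊎ A v (inj₁ x) (inj₂ j) = ⌊ x ≟ v ⌋ ∧ attach j
P-adj⊎ A v (inj₂ j) (inj₁ x) = ⌊ x ≟ v ⌋ ∧ attach j
P-adj⊎ A v (inj₂ i) (inj₂ j) = newAdj i j

𝒫 : ∀ {n} → AdjRel n → Fin n → AdjRel (n + 6)
𝒫 {n} A v x y = P-adj⊎ A v (splitAt n x) (splitAt n y)

{-# OPTIONS --safe #-}
module Submission where

-- Name the triangle t₁ t₂ and the pentagon v p₁ p₂ p₃ p₄ v. The rows of the new vertices
-- force any kernel vector to take the value −x_v on t₁, t₂, p₂, p₃ and x_v on p₁, p₄. These
-- four neighbours of v sum to 0, so the row of v is unchanged and the restriction to G lies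
-- in the kernel of G. Conversely every kernel vector of G extends this way, and the
-- extension has no zero entry because x_v ≠ 0.

open import Defs
open import Data.Nat using (ℕ) renaming (_+_ to _+ℕ_)
open import Data.Fin using (Fin)

import Data.Nat.Properties as ℕ
open import Data.Fin using (zero; suc; splitAt; join; _↑ˡ_; _↑ʳ_; _≟_)
open import Data.Fin.Properties using (suc-injective; splitAt-join; join-splitAt; all?)
open import Data.Bool using (Bool; true; false; if_then_else_; _∧_)
open import Data.Bool.Properties using () renaming (_≟_ to _≟ᵇ_)
open import Data.Sum using (_⊎_; inj₁; inj₂)
import Data.Sum as Sum
open import Data.Product using (∃; _,_; proj₁)
open import Function using (_∘_)
open import Data.Vec using (Vec; _∷_; tabulate)
open import Data.Rational using (ℚ; 0ℚ; 1ℚ; -_; _+_; _*_)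
import Data.Rational.Properties as ℚ
open import Data.Rational.Solver using (module +-*-Solver)
open +-*-Solver using (Polynomial; con; var; _:+_; _:*_; :-_; _:=_; prove; solve)
open import Algebra.Properties.Group ℚ.+-0-group using (inverseʳ-unique; ⁻¹-involutive)
open import Relation.Nullary using (yes; no; contradiction)
open import Relation.Nullary.Decidable using (⌊_⌋; from-yes)
open import Relation.Binary.PropositionalEquality

∑-cong : ∀ {n} {f g : Fin n → ℚ} → (∀ i → f i ≡ g i) → ∑ f ≡ ∑ g
∑-cong {ℕ.zero}  f≗g = refl
∑-cong {ℕ.suc n} f≗g = cong₂ _+_ (f≗g zero) (∑-cong (f≗g ∘ suc))

∑-zero : ∀ {n} {f : Fin n → ℚ} → (∀ i → f i ≡ 0ℚ) → ∑ f ≡ 0ℚ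
∑-zero {ℕ.zero}  f≗0 = refl
∑-zero {ℕ.suc n} f≗0 = trans (cong₂ _+_ (f≗0 zero) (∑-zero (f≗0 ∘ suc))) (ℚ.+-identityˡ 0ℚ)

∑-single : ∀ {n} {f : Fin n → ℚ} (v : Fin n) → (∀ i → i ≢ v → f i ≡ 0ℚ) → ∑ f ≡ f v
∑-single {f = f} zero f≗0 =
  trans (cong (f zero +_) (∑-zero λ i → f≗0 (suc i) λ ())) (ℚ.+-identityʳ (f zero))
∑-single {f = f} (suc v) f≗0 =
  trans (cong₂ _+_ (f≗0 zero λ ()) (∑-single v λ i i≢v → f≗0 (suc i) (i≢v ∘ suc-injective)))
        (ℚ.+-identityˡ (f (suc v)))

∑-splitAt : ∀ m {n} (g : Fin m ⊎ Fin n → ℚ) →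
            ∑ (g ∘ splitAt m) ≡ ∑ (g ∘ inj₁) + ∑ (g ∘ inj₂)
∑-splitAt ℕ.zero    g = sym (ℚ.+-identityˡ _)
∑-splitAt (ℕ.suc m) g = begin
  g (inj₁ zero) + ∑ (g ∘ Sum.map₁ suc ∘ splitAt m)
    ≡⟨ cong (g (inj₁ zero) +_) (∑-splitAt m (g ∘ Sum.map₁ suc)) ⟩
  g (inj₁ zero) + (∑ (g ∘ inj₁ ∘ suc) + ∑ (g ∘ inj₂))
    ≡⟨ ℚ.+-assoc (g (inj₁ zero)) _ _ ⟨
  ∑ (g ∘ inj₁) + ∑ (g ∘ inj₂) ∎
  where open ≡-Reasoning

indicator-* : ∀ b q → (if b then 1ℚ else 0ℚ) * q ≡ (if b then q else 0ℚ)
indicator-* true  q = ℚ.*-identityˡ q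
indicator-* false q = ℚ.*-zeroˡ q

≟-refl : ∀ {n} (v : Fin n) → ⌊ v ≟ v ⌋ ≡ true
≟-refl v = cong ⌊_⌋ (≡-≟-identity _≟_ refl)

∑-δ : ∀ {n} (v : Fin n) (b : Bool) (f : Fin n → ℚ) →
      ∑ (λ i → (if ⌊ i ≟ v ⌋ ∧ b then 1ℚ else 0ℚ) * f i) ≡ (if b then f v else 0ℚ)
∑-δ v b f = trans (∑-single v vanishes) at-v
  where
  vanishes : ∀ i → i ≢ v → (if ⌊ i ≟ v ⌋ ∧ b then 1ℚ else 0ℚ) * f i ≡ 0ℚ
  vanishes i i≢v with i ≟ v
  ... | yes i≡v = contradiction i≡v i≢v
  ... | no _    = ℚ.*-zeroˡ (f i)
  at-v : (if ⌊ v ≟ v ⌋ ∧ b then 1ℚ else 0ℚ) * f v ≡ (if b then f v else 0ℚ)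
  at-v rewrite ≟-refl v = indicator-* b (f v)

if-zero : ∀ b {q} → q ≡ 0ℚ → (if b then q else 0ℚ) ≡ 0ℚ
if-zero true  q≡0 = q≡0
if-zero false _   = refl

Reach-trans : ∀ {n} {B : AdjRel n} {u w x} → Reach B u w → Reach B w x → Reach B u x
Reach-trans here       q = q
Reach-trans (step e r) q = step e (Reach-trans r q)

Reach-sym : ∀ {n} {B : AdjRel n} → (∀ a b → B a b ≡ B b a) → ∀ {u w} → Reach B u w → Reach B w u
Reach-sym B-sym here       = here
Reach-sym B-sym (step e r) = Reach-trans (Reach-sym B-sym r) (step (trans (B-sym _ _) e) here)

Reach-map : ∀ {m n} {B : AdjRel m} {C : AdjRel n} (f : Fin m → Fin n) →
            (∀ {u w} → B u w ≡ true → C (f u) (f w) ≡ true) →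
            ∀ {u w} → Reach B u w → Reach C (f u) (f w)
Reach-map f hom here       = here
Reach-map f hom (step e r) = step (hom e) (Reach-map f hom r)

hub⇒connected : ∀ {n} {B : AdjRel n} → (∀ a b → B a b ≡ B b a) →
                (h : Fin n) → (∀ u → Reach B u h) → IsConnected B
hub⇒connected B-sym h to-h u w = Reach-trans (to-h u) (Reach-sym B-sym (to-h w))

pattern t₁ = zero
pattern t₂ = suc zero
pattern p₁ = suc (suc zero)
pattern p₂ = suc (suc (suc zero))
pattern p₃ = suc (suc (suc (suc zero)))
pattern p₄ = suc (suc (suc (suc (suc zero))))

newAdj-sym : ∀ i j → newAdj i j ≡ newAdj j i
newAdj-sym = from-yes (all? λ i → all? λ j → newAdj i j ≟ᵇ newAdj j i)

newAdj-irrefl : ∀ i → newAdj i i ≡ false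
newAdj-irrefl = from-yes (all? λ i → newAdj i i ≟ᵇ false)

signed : Fin 6 → ℚ → ℚ
signed p₁ q = q
signed p₄ q = q
signed _  q = - q

signed-* : ∀ j c q → signed j (c * q) ≡ c * signed j q
signed-* t₁ c q = ℚ.neg-distribʳ-* c q
signed-* t₂ c q = ℚ.neg-distribʳ-* c q
signed-* p₁ c q = refl
signed-* p₂ c q = ℚ.neg-distribʳ-* c q
signed-* p₃ c q = ℚ.neg-distribʳ-* c q
signed-* p₄ c q = refl

signed-≢0 : ∀ j {q} → q ≢ 0ℚ → signed j q ≢ 0ℚ
signed-≢0 t₁ q≢0 = q≢0 ∘ ℚ.neg-injective
signed-≢0 t₂ q≢0 = q≢0 ∘ ℚ.neg-injective
signed-≢0 p₁ q≢0 = q≢0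
signed-≢0 p₂ q≢0 = q≢0 ∘ ℚ.neg-injective
signed-≢0 p₃ q≢0 = q≢0 ∘ ℚ.neg-injective
signed-≢0 p₄ q≢0 = q≢0

module Pendant {n : ℕ} (A : AdjRel n) (v : Fin n) where

  Vertex : Set
  Vertex = Fin n ⊎ Fin 6

  adj⊎ : Vertex → Vertex → ℚ
  adj⊎ s t = if P-adj⊎ A v s t then 1ℚ else 0ℚ

  row⊎ : (Vertex → ℚ) → Vertex → ℚ
  row⊎ w s = ∑ (λ i → adj⊎ s (inj₁ i) * w (inj₁ i)) + ∑ (λ j → adj⊎ s (inj₂ j) * w (inj₂ j))

  Kernel⊎ : (Vertex → ℚ) → Set
  Kernel⊎ w = ∀ s → row⊎ w s ≡ 0ℚ

  row-𝒫 : ∀ w k → ∑ (λ l → adjMat (𝒫 A v) k l * w (splitAt n l)) ≡ row⊎ w (splitAt n k)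
  row-𝒫 w k = ∑-splitAt n (λ t → adj⊎ (splitAt n k) t * w t)

  Kernel⊎⇒InKernel : ∀ {w} → Kernel⊎ w → InKernel (𝒫 A v) (w ∘ splitAt n)
  Kernel⊎⇒InKernel {w} w∈ker k = trans (row-𝒫 w k) (w∈ker (splitAt n k))

  InKernel⇒Kernel⊎ : ∀ {z} → InKernel (𝒫 A v) z → Kernel⊎ (z ∘ join n 6)
  InKernel⇒Kernel⊎ {z} z∈ker s = begin
    row⊎ w s                                          ≡⟨ cong (row⊎ w) (splitAt-join n 6 s) ⟨
    row⊎ w (splitAt n k)                              ≡⟨ row-𝒫 w k ⟨
    ∑ (λ l → adjMat (𝒫 A v) k l * w (splitAt n l))   ≡⟨ ∑-cong (λ l → cong (λ q → adjMat (𝒫 A v) k l * z q) (join-splitAt n 6 l)) ⟩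
    ∑ (λ l → adjMat (𝒫 A v) k l * z l)               ≡⟨ z∈ker k ⟩
    0ℚ                                                ∎
    where
    open ≡-Reasoning
    w : Vertex → ℚ
    w = z ∘ join n 6
    k : Fin (n +ℕ 6)
    k = join n 6 s

  -- I and O prefix a term with coefficient 1 resp. 0, so that the left-hand sides below
  -- spell out rows of the adjacency matrix of the six new vertices.
  I O : Polynomial 7 → Polynomial 7 → Polynomial 7
  I q r = con 1ℚ :* q :+ r
  O q r = con 0ℚ :* q :+ r

  X nil : Polynomial 7
  X   = var zero
  nil = con 0ℚ

  Y : Fin 6 → Polynomial 7
  Y k = var (suc k)

  env : (Vertex → ℚ) → Vec ℚ 7
  env w = w (inj₁ v) ∷ tabulate (w ∘ inj₂)

  attachedSum : (Vertex → ℚ) → ℚ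
  attachedSum w = w (inj₂ t₁) + (w (inj₂ t₂) + (w (inj₂ p₁) + w (inj₂ p₄)))

  row⊎-old : ∀ w a → row⊎ w (inj₁ a) ≡
             ∑ (λ i → adjMat A a i * w (inj₁ i)) + (if ⌊ a ≟ v ⌋ then attachedSum w else 0ℚ)
  row⊎-old w a = cong (∑ (λ i → adjMat A a i * w (inj₁ i)) +_) (attached ⌊ a ≟ v ⌋)
    where
    attached : ∀ b → ∑ (λ j → (if b ∧ attach j then 1ℚ else 0ℚ) * w (inj₂ j)) ≡
                     (if b then attachedSum w else 0ℚ)
    attached true  = prove (env w) (I (Y t₁) (I (Y t₂) (I (Y p₁) (O (Y p₂) (O (Y p₃) (I (Y p₄) nil))))))
                                   (Y t₁ :+ (Y t₂ :+ (Y p₁ :+ Y p₄))) refl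
    attached false = ∑-zero (λ j → ℚ.*-zeroˡ (w (inj₂ j)))

  newRow : (Vertex → ℚ) → Fin 6 → ℚ
  newRow w t₁ = w (inj₁ v)  + w (inj₂ t₂)
  newRow w t₂ = w (inj₁ v)  + w (inj₂ t₁)
  newRow w p₁ = w (inj₁ v)  + w (inj₂ p₂)
  newRow w p₂ = w (inj₂ p₁) + w (inj₂ p₃)
  newRow w p₃ = w (inj₂ p₂) + w (inj₂ p₄)
  newRow w p₄ = w (inj₁ v)  + w (inj₂ p₃)

  row⊎-new : ∀ w j → row⊎ w (inj₂ j) ≡ newRow w j
  row⊎-new w j = trans (cong (_+ ∑ (λ k → adjMat newAdj j k * w (inj₂ k))) (∑-δ v (attach j) (w ∘ inj₁)))
                       (reduce j)
    where
    reduce : ∀ j → (if attach j then w (inj₁ v) else 0ℚ) + ∑ (λ k → adjMat newAdj j k * w (inj₂ k)) ≡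
                   newRow w j
    reduce t₁ = prove (env w) (X :+ O (Y t₁) (I (Y t₂) (O (Y p₁) (O (Y p₂) (O (Y p₃) (O (Y p₄) nil)))))) (X :+ Y t₂) refl
    reduce t₂ = prove (env w) (X :+ I (Y t₁) (O (Y t₂) (O (Y p₁) (O (Y p₂) (O (Y p₃) (O (Y p₄) nil)))))) (X :+ Y t₁) refl
    reduce p₁ = prove (env w) (X :+ O (Y t₁) (O (Y t₂) (O (Y p₁) (I (Y p₂) (O (Y p₃) (O (Y p₄) nil)))))) (X :+ Y p₂) refl
    reduce p₂ = prove (env w) (nil :+ O (Y t₁) (O (Y t₂) (I (Y p₁) (O (Y p₂) (I (Y p₃) (O (Y p₄) nil)))))) (Y p₁ :+ Y p₃) refl
    reduce p₃ = prove (env w) (nil :+ O (Y t₁) (O (Y t₂) (O (Y p₁) (I (Y p₂) (O (Y p₃) (I (Y p₄) nil)))))) (Y p₂ :+ Y p₄) refl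
    reduce p₄ = prove (env w) (X :+ O (Y t₁) (O (Y t₂) (O (Y p₁) (O (Y p₂) (I (Y p₃) (O (Y p₄) nil)))))) (X :+ Y p₃) refl

  extend : (Fin n → ℚ) → Vertex → ℚ
  extend x (inj₁ i) = x i
  extend x (inj₂ j) = signed j (x v)

  extend-* : ∀ {x y} c → (∀ i → y i ≡ c * x i) → ∀ s → extend y s ≡ c * extend x s
  extend-* c y≗cx (inj₁ i) = y≗cx i
  extend-* {x} c y≗cx (inj₂ j) = trans (cong (signed j) (y≗cx v)) (signed-* j c (x v))

  extend-≢0 : ∀ {x} → (∀ i → x i ≢ 0ℚ) → ∀ s → extend x s ≢ 0ℚ
  extend-≢0 x≢0 (inj₁ i) = x≢0 i
  extend-≢0 x≢0 (inj₂ j) = signed-≢0 j (x≢0 v)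

  attachedSum-extend : ∀ x → attachedSum (extend x) ≡ 0ℚ
  attachedSum-extend x = solve 1 (λ q → :- q :+ (:- q :+ (q :+ q)) := con 0ℚ) refl (x v)

  attachedSum-cong : ∀ {w w′} → (∀ s → w s ≡ w′ s) → attachedSum w ≡ attachedSum w′
  attachedSum-cong w≗w′ =
    cong₂ _+_ (w≗w′ _) (cong₂ _+_ (w≗w′ _) (cong₂ _+_ (w≗w′ _) (w≗w′ _)))

  extend-inKernel : ∀ {x} → InKernel A x → Kernel⊎ (extend x)
  extend-inKernel {x} x∈ker (inj₁ a) = begin
    row⊎ (extend x) (inj₁ a)
      ≡⟨ row⊎-old (extend x) a ⟩
    ∑ (λ i → adjMat A a i * x i) + (if ⌊ a ≟ v ⌋ then attachedSum (extend x) else 0ℚ)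
      ≡⟨ cong₂ _+_ (x∈ker a) (if-zero ⌊ a ≟ v ⌋ (attachedSum-extend x)) ⟩
    0ℚ + 0ℚ
      ≡⟨ ℚ.+-identityˡ 0ℚ ⟩
    0ℚ ∎
    where open ≡-Reasoning
  extend-inKernel {x} x∈ker (inj₂ j) = trans (row⊎-new (extend x) j) (cancels j)
    where
    cancels : ∀ j → newRow (extend x) j ≡ 0ℚ
    cancels t₁ = ℚ.+-inverseʳ (x v)
    cancels t₂ = ℚ.+-inverseʳ (x v)
    cancels p₁ = ℚ.+-inverseʳ (x v)
    cancels p₂ = ℚ.+-inverseʳ (x v)
    cancels p₃ = ℚ.+-inverseˡ (x v)
    cancels p₄ = ℚ.+-inverseʳ (x v)

  Kernel⊎⇒≗extend : ∀ {w} → Kernel⊎ w → ∀ s → w s ≡ extend (w ∘ inj₁) s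
  Kernel⊎⇒≗extend {w} w∈ker (inj₁ i) = refl
  Kernel⊎⇒≗extend {w} w∈ker (inj₂ j) = forced j
    where
    newRow≡0 : ∀ j → newRow w j ≡ 0ℚ
    newRow≡0 j = trans (sym (row⊎-new w j)) (w∈ker (inj₂ j))
    forced : ∀ j → w (inj₂ j) ≡ signed j (w (inj₁ v))
    forced t₁ = inverseʳ-unique _ _ (newRow≡0 t₂)
    forced t₂ = inverseʳ-unique _ _ (newRow≡0 t₁)
    forced p₂ = inverseʳ-unique _ _ (newRow≡0 p₁)
    forced p₃ = inverseʳ-unique _ _ (newRow≡0 p₄)
    forced p₁ = trans (inverseʳ-unique _ _ (trans (ℚ.+-comm (w (inj₂ p₃)) (w (inj₂ p₁))) (newRow≡0 p₂)))
                      (trans (cong -_ (forced p₃)) (⁻¹-involutive _))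
    forced p₄ = trans (inverseʳ-unique _ _ (newRow≡0 p₃))
                      (trans (cong -_ (forced p₂)) (⁻¹-involutive _))

  Kernel⊎-restrict : ∀ {w} → Kernel⊎ w → InKernel A (w ∘ inj₁)
  Kernel⊎-restrict {w} w∈ker a = begin
    ∑ (λ i → adjMat A a i * w (inj₁ i))
      ≡⟨ ℚ.+-identityʳ _ ⟨
    ∑ (λ i → adjMat A a i * w (inj₁ i)) + 0ℚ
      ≡⟨ cong (∑ (λ i → adjMat A a i * w (inj₁ i)) +_) (if-zero ⌊ a ≟ v ⌋ attachedSum≡0) ⟨
    ∑ (λ i → adjMat A a i * w (inj₁ i)) + (if ⌊ a ≟ v ⌋ then attachedSum w else 0ℚ)
      ≡⟨ row⊎-old w a ⟨
    row⊎ w (inj₁ a)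
      ≡⟨ w∈ker (inj₁ a) ⟩
    0ℚ ∎
    where
    open ≡-Reasoning
    attachedSum≡0 : attachedSum w ≡ 0ℚ
    attachedSum≡0 = trans (attachedSum-cong (Kernel⊎⇒≗extend {w} w∈ker)) (attachedSum-extend (w ∘ inj₁))

  kernel-spanned : ∀ {x} → (∀ y → InKernel A y → ∃ λ c → ∀ i → y i ≡ c * x i) →
                   ∀ z → InKernel (𝒫 A v) z → ∃ λ c → ∀ k → z k ≡ c * extend x (splitAt n k)
  kernel-spanned {x} x-spans z z∈ker =
    let c , w≗cx = x-spans (w ∘ inj₁) (Kernel⊎-restrict {w} w∈ker) in
    c , λ k → begin
      z k                             ≡⟨ cong z (join-splitAt n 6 k) ⟨
      w (splitAt n k)                 ≡⟨ Kernel⊎⇒≗extend {w} w∈ker (splitAt n k) ⟩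
      extend (w ∘ inj₁) (splitAt n k) ≡⟨ extend-* c w≗cx (splitAt n k) ⟩
      c * extend x (splitAt n k)      ∎
    where
    open ≡-Reasoning
    w : Vertex → ℚ
    w = z ∘ join n 6
    w∈ker : Kernel⊎ w
    w∈ker = InKernel⇒Kernel⊎ {z} z∈ker

  𝒫-simple : IsSimple A → IsSimple (𝒫 A v)
  𝒫-simple (A-sym , A-irrefl) = (λ a b → sym⊎ (splitAt n a) (splitAt n b)) , (irrefl⊎ ∘ splitAt n)
    where
    sym⊎ : ∀ s t → P-adj⊎ A v s t ≡ P-adj⊎ A v t s
    sym⊎ (inj₁ a) (inj₁ b) = A-sym a b
    sym⊎ (inj₁ a) (inj₂ j) = refl
    sym⊎ (inj₂ i) (inj₁ b) = refl
    sym⊎ (inj₂ i) (inj₂ j) = newAdj-sym i j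
    irrefl⊎ : ∀ s → P-adj⊎ A v s s ≡ false
    irrefl⊎ (inj₁ a) = A-irrefl a
    irrefl⊎ (inj₂ j) = newAdj-irrefl j

  𝒫-edge : ∀ s t → P-adj⊎ A v s t ≡ true → 𝒫 A v (join n 6 s) (join n 6 t) ≡ true
  𝒫-edge s t = subst₂ (λ s′ t′ → P-adj⊎ A v s′ t′ ≡ true) (sym (splitAt-join n 6 s)) (sym (splitAt-join n 6 t))

  𝒫-connected : IsSimple A → IsConnected A → IsConnected (𝒫 A v)
  𝒫-connected simple connected = hub⇒connected (proj₁ (𝒫-simple simple)) (v ↑ˡ 6) λ k →
    subst (λ k → Reach (𝒫 A v) k (v ↑ˡ 6)) (join-splitAt n 6 k) (to-v (splitAt n k))
    where
    attached-step : ∀ j → attach j ≡ true → Reach (𝒫 A v) (n ↑ʳ j) (v ↑ˡ 6)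
    attached-step j attached = step (𝒫-edge (inj₂ j) (inj₁ v) edge) here
      where
      edge : P-adj⊎ A v (inj₂ j) (inj₁ v) ≡ true
      edge rewrite ≟-refl v = attached
    to-v : ∀ s → Reach (𝒫 A v) (join n 6 s) (v ↑ˡ 6)
    to-v (inj₁ a)  = Reach-map (_↑ˡ 6) (λ {b} {c} → 𝒫-edge (inj₁ b) (inj₁ c)) (connected a v)
    to-v (inj₂ t₁) = attached-step t₁ refl
    to-v (inj₂ t₂) = attached-step t₂ refl
    to-v (inj₂ p₁) = attached-step p₁ refl
    to-v (inj₂ p₄) = attached-step p₄ refl
    to-v (inj₂ p₂) = step (𝒫-edge (inj₂ p₂) (inj₂ p₁) refl) (to-v (inj₂ p₁))
    to-v (inj₂ p₃) = step (𝒫-edge (inj₂ p₃) (inj₂ p₄) refl) (to-v (inj₂ p₄))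

proposition18 : ∀ {n : ℕ} (A : AdjRel n) (v : Fin n) → IsNut A → IsNut (𝒫 A v)
proposition18 {n} A v (2≤n , simple , connected , x , x∈ker , x≢0 , x-spans) =
  ℕ.≤-trans 2≤n (ℕ.m≤m+n n 6) ,
  𝒫-simple simple ,
  𝒫-connected simple connected ,
  extend x ∘ splitAt n ,
  Kernel⊎⇒InKernel {extend x} (extend-inKernel x∈ker) ,
  extend-≢0 x≢0 ∘ splitAt n ,
  kernel-spanned x-spans
  where open Pendant A v
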